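{- For $N\in\mathbb N$ and $n\in\mathbb N$ the matrices $B(n,n-1)$ and $A(n,n-1)$ are $1\times1$ matrices and \[B(n,n-1)=A(n,n-1)=N^{\lceil n/2\rceil},\qquad\text{so}\qquad \det B(n,n-1)=\det A(n,n-1)=N^{\lceil n/2\rceil}.\]
   Context: $\mathcal{NC}(0,n)$ is the set of non-crossing partitions of $\{1,\dots,n\}$. For $0\le r<n$ with $s=\lfloor r/2\rfloor$: if $r=2s$, $W(n,r)$ is the set of $p\in\mathcal{NC}(0,n)$ in which none of $1,\dots,s$ is a singleton and $1,\dots,s+1$ lie in pairwise different blocks; if $r=2s+1$, $W(n,r)$ is the set of $p$ in which none of $1,\dots,s+1$ is a singleton and they lie in pairwise different blocks; $W(n,n)=\emptyset$; $Y(n,r)=W(n,r)\setminus W(n,r+1)$. For $p,q\in\mathcal{NC}(0,n)$, $G(p,q)$ is the graph on vertices $\{1,\dots,n\}\cup\{1',\dots,n'\}$ with an edge between $a,b$ if they are in the same block of $p$, between $a',b'$ if $a,b$ are in the same block of $q$, and between $i,i'$ for every $i$; $c(p,q)$ is its number of connected components. $H_r(p,q)$ is $G(p,q)$ with the edges $\{i,i'\}$, $1\le i\le s+1$, deleted. $G(p,q)$ is $r$-flawless if in $H_r(p,q)$: (1) $1,\dots,s+1$ are pairwise not connected; (2) $1',\dots,(s+1)'$ are pairwise not connected; (3) $i$ and $i'$ are connected for $1\le i\le s$; (4) if $r$ is odd, $s+1$ and $(s+1)'$ are connected; otherwise it has an $r$-flaw. $e_r(p,q)=0$ if $G(p,q)$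 has an $r$-flaw, else $N^{c(p,q)}$. $A(n,r)=(e_r(p,q))_{p,q\in W(n,r)}$; $B(n,r)$ is its restriction to rows and columns in $Y(n,r)$. -}

module Defs where

open import Data.Nat using (ℕ; zero; suc; _+_; _*_; _∸_; _^_; _≤_; _<_; ⌊_/2⌋; _%_; _≤ᵇ_; _<ᵇ_; _≡ᵇ_)
open import Data.Fin using (Fin; toℕ) renaming (_≟_ to _≟F_)
open import Data.Bool using (Bool; true; false; _∧_; _∨_; not; if_then_else_)
open import Data.List using (List; map; _++_; allFin)
open import Data.Bool.ListAction using (all; any)
open import Data.Nat.ListAction using (sum)
open import Data.Product using (_×_; _,_; ∃)
open import Relation.Nullary using (¬_)
open import Relation.Nullary.Decidable using (⌊_⌋)
open import Relation.Binary.PropositionalEquality using (_≡_; _≢_)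

-- Points 1..n of the paper are represented by Fin n (point i ↦ index i-1).
-- A set partition of {1..n} is represented canonically by the map sending each
-- point to the least element of its block: lab is idempotent and lab i ≤ i.
record NC (n : ℕ) : Set where
  field
    lab      : Fin n → Fin n
    lab-idem : ∀ i → lab (lab i) ≡ lab i
    lab-min  : ∀ i → toℕ (lab i) ≤ toℕ i
    noncrossing : ∀ a b c d → toℕ a < toℕ b → toℕ b < toℕ c → toℕ c < toℕ d →
                  lab a ≡ lab c → lab b ≡ lab d → lab a ≡ lab b
open NC public

sameB : ∀ {n} → NC n → Fin n → Fin n → Bool
sameB p i j = ⌊ lab p i ≟F lab p j ⌋

eqF : ∀ {n} → Fin n → Fin n → Bool
eqF i j = ⌊ i ≟F j ⌋

half : ℕ → ℕ
half r = ⌊ r /2⌋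

isOdd : ℕ → Bool
isOdd r = (r % 2) ≡ᵇ 1

-- number of leading points that must not be singletons (0-based indices < bound)
-- r = 2s : points 1..s ; r = 2s+1 : points 1..s+1
nsBound : ℕ → ℕ
nsBound r = if isOdd r then suc (half r) else half r

NotSingleton : ∀ {n} → NC n → Fin n → Set
NotSingleton p i = ∃ λ j → (j ≢ i) × (lab p j ≡ lab p i)

-- W(n,r) for r ≤ n (W(n,n) = ∅ because of the r < n component)
W : (n r : ℕ) → NC n → Set
W n r p = (r < n)
        × (∀ i → toℕ i < nsBound r → NotSingleton p i)
        × (∀ i j → toℕ i ≤ half r → toℕ j ≤ half r → i ≢ j → lab p i ≢ lab p j)

Y : (n r : ℕ) → NC n → Set
Y n r p = W n r p × ¬ W n (suc r) p

-- Graph G(p,q): vertices (false , i) = i and (true , i) = i'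
Vertex : ℕ → Set
Vertex n = Bool × Fin n

vertices : (n : ℕ) → List (Vertex n)
vertices n = map (false ,_) (allFin n) ++ map (true ,_) (allFin n)

eqB : Bool → Bool → Bool
eqB true  b = b
eqB false b = not b

eqV : ∀ {n} → Vertex n → Vertex n → Bool
eqV (b , i) (c , j) = eqB b c ∧ eqF i j

-- edge set of G(p,q) when `keep i` says whether the edge {i,i'} is present
edges : ∀ {n} → (Fin n → Bool) → NC n → NC n → Vertex n → Vertex n → Bool
edges keep p q (false , i) (false , j) = sameB p i j
edges keep p q (true  , i) (true  , j) = sameB q i j
edges keep p q (false , i) (true  , j) = eqF i j ∧ keep i
edges keep p q (true  , i) (false , j) = eqF i j ∧ keep i

edgesG : ∀ {n} → NC n → NC n → Vertex n → Vertex n → Bool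
edgesG = edges (λ _ → true)

-- H_r(p,q): delete edges {i,i'} for 1 ≤ i ≤ s+1 (0-based: toℕ i ≤ s)
edgesH : ∀ {n} → ℕ → NC n → NC n → Vertex n → Vertex n → Bool
edgesH r = edges (λ i → not (toℕ i ≤ᵇ half r))

reach : ∀ {n} → (Vertex n → Vertex n → Bool) → ℕ → Vertex n → Vertex n → Bool
reach E zero    u w = eqV u w
reach {n} E (suc k) u w = reach E k u w ∨ any (λ v → reach E k u v ∧ E v w) (vertices n)

connected : ∀ {n} → (Vertex n → Vertex n → Bool) → Vertex n → Vertex n → Bool
connected {n} E = reach E (2 * n)

rank : ∀ {n} → Vertex n → ℕ
rank (false , i) = toℕ i
rank {n} (true , i) = n + toℕ i

components : ∀ {n} → (Vertex n → Vertex n → Bool) → ℕ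
components {n} E =
  sum (map (λ v → if any (λ u → (rank u <ᵇ rank v) ∧ connected E u v) (vertices n)
                  then 0 else 1) (vertices n))

c : ∀ {n} → NC n → NC n → ℕ
c p q = components (edgesG p q)

flawless : ∀ {n} → ℕ → NC n → NC n → Bool
flawless {n} r p q =
     all (λ i → all (λ j → not ((toℕ i ≤ᵇ s) ∧ (toℕ j ≤ᵇ s) ∧ not (eqF i j))
                          ∨ not (C (false , i) (false , j))) fs) fs
   ∧ all (λ i → all (λ j → not ((toℕ i ≤ᵇ s) ∧ (toℕ j ≤ᵇ s) ∧ not (eqF i j))
                          ∨ not (C (true , i) (true , j))) fs) fs
   ∧ all (λ i → not (toℕ i <ᵇ s) ∨ C (false , i) (true , i)) fs
   ∧ (not (isOdd r) ∨ all (λ i → not (toℕ i ≡ᵇ s) ∨ C (false , i) (true , i)) fs)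
  where
    s  = half r
    fs = allFin n
    C  = connected (edgesH r p q)

e : (N : ℕ) → ∀ {n} → ℕ → NC n → NC n → ℕ
e N r p q = if flawless r p q then N ^ c p q else 0

A : (N n r : ℕ) → (p q : NC n) → W n r p → W n r q → ℕ
A N n r p q _ _ = e N r p q

B : (N n r : ℕ) → (p q : NC n) → Y n r p → Y n r q → ℕ
B N n r p q _ _ = e N r p q

_≈P_ : ∀ {n} → NC n → NC n → Set
p ≈P q = ∀ i → lab p i ≡ lab q i

module Submission where

open import Defs
open import Data.Nat using (ℕ; zero; suc; _+_; _*_; _∸_; _^_; _≤_; _<_; ⌈_/2⌉; z≤n; s≤s; _≤ᵇ_; _<ᵇ_; _≤?_; _<?_; s≤s⁻¹)
open import Data.Nat.Properties
open import Data.Nat.ListAction using (sum)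
open import Data.Nat.ListAction.Properties using (sum-++)
open import Data.Fin using (Fin; toℕ; fromℕ<; opposite) renaming (zero to fzero; suc to fsuc; _≟_ to _≟F_)
open import Data.Fin.Properties using (toℕ-injective; toℕ<n; toℕ-fromℕ<; opposite-prop; opposite-involutive)
open import Data.Bool using (Bool; true; false; _∧_; _∨_; not; if_then_else_; T)
open import Data.Bool.Properties using (T-∧; T-∨)
open import Data.Bool.ListAction using (all; any)
open import Data.Product using (Σ; _×_; _,_; proj₁; proj₂)
open import Data.Sum using (_⊎_; inj₁; inj₂)
open import Data.Empty using (⊥; ⊥-elim)
open import Data.List using (List; []; _∷_; map; _++_; allFin; tabulate)
open import Data.List.Properties using (map-++; map-∘; map-cong; map-tabulate)
open import Data.List.Membership.Propositional using (_∈_; lose)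
open import Data.List.Membership.Propositional.Properties using (∈-map⁺; ∈-++⁺ˡ; ∈-++⁺ʳ; ∈-allFin)
open import Data.List.Relation.Unary.Any using (satisfied)
open import Data.List.Relation.Unary.Any.Properties using (any⁺; any⁻)
open import Data.List.Relation.Unary.All using (universal)
open import Data.List.Relation.Unary.All.Properties using (all⁻)
open import Function.Base using (id; _∘_)
open import Function.Bundles using (Equivalence)
open import Relation.Binary.Definitions using (tri<; tri≈; tri>)
open import Relation.Nullary using (¬_; yes; no)
open import Relation.Nullary.Decidable using (toWitness; fromWitness; toWitnessFalse)
open import Relation.Binary.PropositionalEquality

-- Proposition 5.24.  Let n = m + 1 and r = n - 1 = m; write s = ⌊m/2⌋ and
-- t = nsBound m (the number of leading points that may not be singletons),
-- so that m = s + t and t ∈ {s, s + 1}.  Points are 0-based.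
--
-- W(n,m) has exactly one element, the "rainbow" partition pairing i with
-- m - i (the middle point is a singleton when m is even).  As W(n,m+1) is
-- empty, Y(n,m) = W(n,m), so A(n,m) and B(n,m) are the 1×1 matrix e_m(R,R).

∧-intro : ∀ {a b} → T a → T b → T (a ∧ b)
∧-intro ta tb = Equivalence.from T-∧ (ta , tb)

∧-elim : ∀ {a b} → T (a ∧ b) → T a × T b
∧-elim {a} = Equivalence.to (T-∧ {a})

T-implies : ∀ {a b} → (T a → T b) → T (not a ∨ b)
T-implies {true}  f = f _
T-implies {false} f = _

T-not : ∀ {b} → ¬ T b → T (not b)
T-not {true}  ¬b = ¬b _
T-not {false} ¬b = _

if-true : ∀ {A : Set} {b} {x y : A} → T b → (if b then x else y) ≡ x
if-true {b = true} _ = refl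

if-false : ∀ {A : Set} {b} {x y : A} → ¬ T b → (if b then x else y) ≡ y
if-false {b = true}  ¬b = ⊥-elim (¬b _)
if-false {b = false} _  = refl

all-true : ∀ {A : Set} {f : A → Bool} xs → (∀ x → T (f x)) → T (all f xs)
all-true {f = f} xs holds = all⁻ f (universal holds xs)

eqF-sound : ∀ {n} {i j : Fin n} → T (eqF i j) → i ≡ j
eqF-sound {i = i} {j} = toWitness {a? = i ≟F j}

eqF-complete : ∀ {n} {i j : Fin n} → i ≡ j → T (eqF i j)
eqF-complete {i = i} {j} = fromWitness {a? = i ≟F j}

eqF-distinct : ∀ {n} {i j : Fin n} → T (not (eqF i j)) → i ≢ j
eqF-distinct {i = i} {j} = toWitnessFalse {a? = i ≟F j}

nsBound-cases : ∀ r → nsBound r ≡ half r ⊎ nsBound r ≡ suc (half r)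
nsBound-cases r = by-parity (isOdd r)
  where
    by-parity : ∀ b → (if b then suc (half r) else half r) ≡ half r
                    ⊎ (if b then suc (half r) else half r) ≡ suc (half r)
    by-parity true  = inj₂ refl
    by-parity false = inj₁ refl

half≤nsBound : ∀ r → half r ≤ nsBound r
half≤nsBound r with nsBound-cases r
... | inj₁ t≡s  = ≤-reflexive (sym t≡s)
... | inj₂ t≡s+1 = ≤-trans (n≤1+n _) (≤-reflexive (sym t≡s+1))

nsBound≤1+half : ∀ r → nsBound r ≤ suc (half r)
nsBound≤1+half r with nsBound-cases r
... | inj₁ t≡s  = ≤-trans (≤-reflexive t≡s) (n≤1+n _)
... | inj₂ t≡s+1 = ≤-reflexive t≡s+1

nsBound-odd : ∀ r → T (isOdd r) → nsBound r ≡ suc (half r)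
nsBound-odd r = odd-case (isOdd r)
  where
    odd-case : ∀ b → T b → (if b then suc (half r) else half r) ≡ suc (half r)
    odd-case true _ = refl

nsBound-suc-suc : ∀ r → nsBound (suc (suc r)) ≡ suc (nsBound r)
nsBound-suc-suc r = lift (isOdd r)
  where
    lift : ∀ b → (if b then suc (suc (half r)) else suc (half r))
               ≡ suc (if b then suc (half r) else half r)
    lift true  = refl
    lift false = refl

half+nsBound : ∀ r → half r + nsBound r ≡ r
half+nsBound zero          = refl
half+nsBound (suc zero)    = refl
half+nsBound (suc (suc r)) = begin
  suc (half r) + nsBound (suc (suc r)) ≡⟨ cong (suc (half r) +_) (nsBound-suc-suc r) ⟩
  suc (half r + suc (nsBound r))       ≡⟨ cong suc (+-suc (half r) (nsBound r)) ⟩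
  suc (suc (half r + nsBound r))       ≡⟨ cong (suc ∘ suc) (half+nsBound r) ⟩
  suc (suc r)                          ∎
  where open ≡-Reasoning

below-nsBound : ∀ {r i} → i < nsBound r → i ≤ half r
below-nsBound {r} i<t = s≤s⁻¹ (≤-trans i<t (nsBound≤1+half r))

decreasing-shift : (f : ℕ → ℕ) (t : ℕ) → (∀ k → suc k < t → f (suc k) < f k) →
                   ∀ i j → i ≤ j → j < t → f j + j ≤ f i + i
decreasing-shift f t dec zero zero z≤n _ = ≤-refl
decreasing-shift f t dec i (suc j) i≤j+1 j+1<t with m≤n⇒m<n∨m≡n i≤j+1
... | inj₂ refl = ≤-refl
... | inj₁ i<j+1 = begin
  f (suc j) + suc j ≡⟨ +-suc (f (suc j)) j ⟩
  suc (f (suc j)) + j ≤⟨ +-monoˡ-≤ j (dec j j+1<t) ⟩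
  f j + j ≤⟨ decreasing-shift f t dec i j (s≤s⁻¹ i<j+1) (<-trans (n<1+n j) j+1<t) ⟩
  f i + i ∎
  where open ≤-Reasoning

nested : ∀ {n} (p : NC n) {a b c d : Fin n} →
         toℕ a < toℕ b → toℕ b < toℕ c →
         lab p a ≡ lab p c → lab p b ≡ lab p d → lab p a ≢ lab p b → toℕ d < toℕ c
nested p {a} {b} {c} {d} a<b b<c a~c b~d a≁b with <-cmp (toℕ d) (toℕ c)
... | tri< d<c _ _ = d<c
... | tri≈ _ d≡c _ = ⊥-elim (a≁b (trans a~c (trans (cong (lab p) (toℕ-injective (sym d≡c))) (sym b~d))))
... | tri> _ _ c<d = ⊥-elim (a≁b (noncrossing p a b c d a<b b<c c<d a~c b~d))

eqV-sound : ∀ {n} (u v : Vertex n) → T (eqV u v) → u ≡ v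
eqV-sound (false , i) (false , j) h = cong (false ,_) (eqF-sound h)
eqV-sound (true  , i) (true  , j) h = cong (true ,_) (eqF-sound h)
eqV-sound (false , i) (true  , j) ()
eqV-sound (true  , i) (false , j) ()

eqV-refl : ∀ {n} (u : Vertex n) → T (eqV u u)
eqV-refl (false , i) = eqF-complete refl
eqV-refl (true  , i) = eqF-complete refl

vertex∈ : ∀ {n} (v : Vertex n) → v ∈ vertices n
vertex∈ (false , i) = ∈-++⁺ˡ (∈-map⁺ (false ,_) (∈-allFin i))
vertex∈ {n} (true , i) = ∈-++⁺ʳ (map (false ,_) (allFin n)) (∈-map⁺ (true ,_) (∈-allFin i))

index≤rank : ∀ {n} (u : Vertex n) → toℕ (proj₂ u) ≤ rank u
index≤rank (false , i) = ≤-refl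
index≤rank {n} (true , i) = m≤n+m (toℕ i) n

module Walks {n : ℕ} (E : Vertex n → Vertex n → Bool) where

  walk-invariant : ∀ {C : Set} (cls : Vertex n → C) →
                   (∀ v w → T (E v w) → cls v ≡ cls w) →
                   ∀ k u w → T (reach E k u w) → cls u ≡ cls w
  walk-invariant cls resp zero u w h = cong cls (eqV-sound u w h)
  walk-invariant cls resp (suc k) u w h with Equivalence.to (T-∨ {reach E k u w}) h
  ... | inj₁ shorter = walk-invariant cls resp k u w shorter
  ... | inj₂ through with satisfied (any⁻ (λ v → reach E k u v ∧ E v w) (vertices n) through)
  ...   | v , uv∧vw = trans (walk-invariant cls resp k u v (proj₁ (∧-elim uv∧vw)))
                            (resp v w (proj₂ (∧-elim {reach E k u v} uv∧vw)))

  walk-extend : ∀ k u v w → T (reach E k u v) → T (E v w) → T (reach E (suc k) u w)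
  walk-extend k u v w uv vw =
    Equivalence.from T-∨ (inj₂ (any⁺ (λ x → reach E k u x ∧ E x w) (lose (vertex∈ v) (∧-intro uv vw))))

  walk-lengthen : ∀ {k k'} u w → k ≤ k' → T (reach E k u w) → T (reach E k' u w)
  walk-lengthen {k' = zero} u w z≤n h = h
  walk-lengthen {k' = suc k'} u w k≤k'+1 h with m≤n⇒m<n∨m≡n k≤k'+1
  ... | inj₂ refl = h
  ... | inj₁ k<k'+1 = Equivalence.from T-∨ (inj₁ (walk-lengthen u w (s≤s⁻¹ k<k'+1) h))

  edge-connected : ∀ u v → T (E u v) → T (connected E u v)
  edge-connected u v uv = walk-lengthen u v one≤2n (walk-extend 0 u u v (eqV-refl u) uv)
    where
      one≤2n : 1 ≤ 2 * n
      one≤2n = ≤-trans (≤-trans (s≤s z≤n) (toℕ<n (proj₂ u))) (m≤m+n n (n + 0))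

open Walks

edge-same-block : ∀ {n} (keep : Fin n → Bool) (p : NC n) v w →
                  T (edges keep p p v w) → lab p (proj₂ v) ≡ lab p (proj₂ w)
edge-same-block keep p (false , i) (false , j) h = eqF-sound h
edge-same-block keep p (true  , i) (true  , j) h = eqF-sound h
edge-same-block keep p (false , i) (true  , j) h = cong (lab p) (eqF-sound (proj₁ (∧-elim h)))
edge-same-block keep p (true  , i) (false , j) h = cong (lab p) (eqF-sound (proj₁ (∧-elim h)))

connected-same-block : ∀ {n} (keep : Fin n → Bool) (p : NC n) u w →
                       T (connected (edges keep p p) u w) → lab p (proj₂ u) ≡ lab p (proj₂ w)
connected-same-block {n} keep p u w =
  walk-invariant (edges keep p p) (λ v → lab p (proj₂ v)) (edge-same-block keep p) (2 * n) u w

module InW {n r : ℕ} {p : NC n} (w : W n r p) where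

  notSingleton : ∀ i → toℕ i < nsBound r → NotSingleton p i
  notSingleton = proj₁ (proj₂ w)

  distinct : ∀ i j → toℕ i ≤ half r → toℕ j ≤ half r → i ≢ j → lab p i ≢ lab p j
  distinct = proj₂ (proj₂ w)

  least-in-block : ∀ i → toℕ i ≤ half r → lab p i ≡ i
  least-in-block i i≤s with lab p i ≟F i
  ... | yes least = least
  ... | no ¬least = ⊥-elim (distinct (lab p i) i (≤-trans (lab-min p i) i≤s) i≤s ¬least (lab-idem p i))

  partner-beyond : ∀ i j → toℕ i ≤ half r → j ≢ i → lab p j ≡ lab p i → half r < toℕ j
  partner-beyond i j i≤s j≢i j~i with toℕ j ≤? half r
  ... | no j≰s = ≰⇒> j≰s
  ... | yes j≤s = ⊥-elim (distinct j i j≤s i≤s j≢i j~i)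

  private
    C : Vertex n → Vertex n → Bool
    C = connected (edgesH r p p)

  -- Each of the first t points reaches its primed copy in H_r(p,p) along
  -- i — j — j' — i', where j is a block-mate beyond s, so {j,j'} is kept.
  primed-connected : ∀ i → toℕ i < nsBound r → T (C (false , i) (true , i))
  primed-connected i i<t = walk-lengthen E (false , i) (true , i) three≤2n
    (walk-extend E 2 (false , i) (true , j) (true , i)
      (walk-extend E 1 (false , i) (false , j) (true , j)
        (walk-extend E 0 (false , i) (false , i) (false , j) (eqV-refl (false , i)) (eqF-complete (sym j~i)))
        (∧-intro (eqF-complete refl) (T-not (<⇒≱ j>s ∘ ≤ᵇ⇒≤ (toℕ j) (half r)))))
      (eqF-complete j~i))
    where
      E = edgesH r p p
      j = proj₁ (notSingleton i i<t)
      j~i : lab p j ≡ lab p i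
      j~i = proj₂ (proj₂ (notSingleton i i<t))
      j>s : half r < toℕ j
      j>s = partner-beyond i j (below-nsBound i<t) (proj₁ (proj₂ (notSingleton i i<t))) j~i
      three≤2n : 3 ≤ 2 * n
      three≤2n = ≤-trans (n≤1+n 3) (*-monoʳ-≤ 2 (≤-trans (s≤s (≤-trans (s≤s z≤n) j>s)) (toℕ<n j)))

  -- Conditions (1) and (2): the points 0, …, s (resp. 0', …, s') are pairwise
  -- disconnected, as they lie over pairwise different blocks.
  separated : ∀ b → T (all (λ i → all (λ j → not ((toℕ i ≤ᵇ half r) ∧ (toℕ j ≤ᵇ half r) ∧ not (eqF i j))
                                                 ∨ not (C (b , i) (b , j))) (allFin n)) (allFin n))
  separated b = all-true (allFin n) λ i → all-true (allFin n) λ j → T-implies λ h →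
    let (i≤s , j≤s∧i≢j) = ∧-elim h
        (j≤s , i≢j) = ∧-elim {toℕ j ≤ᵇ half r} j≤s∧i≢j
    in T-not λ conn → distinct i j (≤ᵇ⇒≤ _ _ i≤s) (≤ᵇ⇒≤ _ _ j≤s) (eqF-distinct i≢j)
                               (connected-same-block _ p (b , i) (b , j) conn)

  -- G(p,p) is r-flawless: conditions (3) and (4) concern points below t.
  diagonal-flawless : T (flawless r p p)
  diagonal-flawless = ∧-intro (separated false) (∧-intro (separated true) (∧-intro
    (all-true (allFin n) λ i → T-implies λ i<s →
       primed-connected i (<-≤-trans (<ᵇ⇒< _ _ i<s) (half≤nsBound r)))
    (T-implies λ odd → all-true (allFin n) λ i → T-implies λ i≡s →
       primed-connected i (subst (toℕ i <_) (sym (nsBound-odd r odd)) (s≤s (≤-reflexive (≡ᵇ⇒≡ _ _ i≡s)))))))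

blockCount : ∀ {n} → NC n → ℕ
blockCount {n} p = sum (map (λ i → if eqF (lab p i) i then 1 else 0) (allFin n))

sum-map-zero : ∀ {A : Set} (xs : List A) → sum (map (λ _ → 0) xs) ≡ 0
sum-map-zero []       = refl
sum-map-zero (x ∷ xs) = sum-map-zero xs

module Diagonal {n : ℕ} (p : NC n) where

  private
    CG : Vertex n → Vertex n → Bool
    CG = connected (edgesG p p)

  leader : Vertex n → ℕ
  leader v = if any (λ u → (rank u <ᵇ rank v) ∧ CG u v) (vertices n) then 0 else 1

  -- A primed vertex i' is preceded by its neighbour i.
  leader-primed : ∀ i → leader (true , i) ≡ 0
  leader-primed i = if-true (any⁺ _ (lose (vertex∈ (false , i))
    (∧-intro (<⇒<ᵇ (<-≤-trans (toℕ<n i) (m≤m+n n (toℕ i))))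
             (edge-connected (edgesG p p) (false , i) (true , i) (∧-intro {eqF i i} (eqF-complete refl) _)))))

  leader-unprimed : ∀ i → leader (false , i) ≡ (if eqF (lab p i) i then 1 else 0)
  leader-unprimed i with lab p i ≟F i
  ... | yes least = if-false (no-earlier ∘ satisfied ∘ any⁻ _ (vertices n))
    where
      no-earlier : Σ (Vertex n) (λ u → T ((rank u <ᵇ toℕ i) ∧ CG u (false , i))) → ⊥
      no-earlier (u , h) = <⇒≱ (<ᵇ⇒< _ _ (proj₁ (∧-elim h))) (begin
        toℕ i                 ≡⟨ cong toℕ (sym (trans (connected-same-block _ p u (false , i) (proj₂ (∧-elim {rank u <ᵇ toℕ i} h))) least)) ⟩
        toℕ (lab p (proj₂ u)) ≤⟨ lab-min p (proj₂ u) ⟩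
        toℕ (proj₂ u)         ≤⟨ index≤rank u ⟩
        rank u                ∎)
        where open ≤-Reasoning
  ... | no ¬least = if-true (any⁺ _ (lose (vertex∈ (false , lab p i))
    (∧-intro (<⇒<ᵇ (≤∧≢⇒< (lab-min p i) (¬least ∘ toℕ-injective)))
             (edge-connected (edgesG p p) (false , lab p i) (false , i) (eqF-complete (lab-idem p i))))))

  components-diagonal : c p p ≡ blockCount p
  components-diagonal = begin
    sum (map leader (map (false ,_) fs ++ map (true ,_) fs))
      ≡⟨ cong sum (map-++ leader (map (false ,_) fs) (map (true ,_) fs)) ⟩
    sum (map leader (map (false ,_) fs) ++ map leader (map (true ,_) fs))
      ≡⟨ sum-++ (map leader (map (false ,_) fs)) _ ⟩
    sum (map leader (map (false ,_) fs)) + sum (map leader (map (true ,_) fs))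
      ≡⟨ cong₂ _+_ (cong sum (trans (sym (map-∘ fs)) (map-cong leader-unprimed fs)))
                   (trans (cong sum (trans (sym (map-∘ fs)) (map-cong leader-primed fs))) (sum-map-zero fs)) ⟩
    blockCount p + 0
      ≡⟨ +-identityʳ _ ⟩
    blockCount p ∎
    where
      open ≡-Reasoning
      fs = allFin n

open Diagonal using (components-diagonal)

count-prefix : ∀ n k (g : Fin n → ℕ) → k ≤ n →
               (∀ i → toℕ i < k → g i ≡ 1) → (∀ i → k ≤ toℕ i → g i ≡ 0) →
               sum (tabulate g) ≡ k
count-prefix zero    zero    g _ _ _ = refl
count-prefix (suc n) zero    g _ _ zeros =
  cong₂ _+_ (zeros fzero z≤n) (count-prefix n zero (g ∘ fsuc) z≤n (λ _ ()) (λ i _ → zeros (fsuc i) z≤n))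
count-prefix (suc n) (suc k) g k<n ones zeros =
  cong₂ _+_ (ones fzero (s≤s z≤n))
            (count-prefix n k (g ∘ fsuc) (s≤s⁻¹ k<n) (λ i i<k → ones (fsuc i) (s≤s i<k)) (λ i k≤i → zeros (fsuc i) (s≤s k≤i)))

-- The rainbow partition of {0, …, m}: i and m - i form a block

module Rainbow (m : ℕ) where

  s t : ℕ
  s = half m
  t = nsBound m

  s+t≡m : s + t ≡ m
  s+t≡m = half+nsBound m

  opposite-sum : (i : Fin (suc m)) → toℕ (opposite i) + toℕ i ≡ m
  opposite-sum i = trans (cong (_+ toℕ i) (opposite-prop i)) (m∸n+n≡m (s≤s⁻¹ (toℕ<n i)))

  mirror-low : ∀ i → s < toℕ i → toℕ (opposite i) ≤ s
  mirror-low i s<i = +-cancelʳ-≤ (toℕ i) (toℕ (opposite i)) s (begin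
    toℕ (opposite i) + toℕ i ≡⟨ trans (opposite-sum i) (sym s+t≡m) ⟩
    s + t                    ≤⟨ +-monoʳ-≤ s (≤-trans (nsBound≤1+half m) s<i) ⟩
    s + toℕ i                ∎)
    where open ≤-Reasoning

  mirror-high : ∀ i → toℕ i < t → s < toℕ (opposite i)
  mirror-high i i<t = +-cancelʳ-< (toℕ i) s (toℕ (opposite i)) (begin-strict
    s + toℕ i                <⟨ +-monoʳ-< s i<t ⟩
    s + t                    ≡⟨ trans s+t≡m (sym (opposite-sum i)) ⟩
    toℕ (opposite i) + toℕ i ∎)
    where open ≤-Reasoning

  rainbowLab : Fin (suc m) → Fin (suc m)
  rainbowLab i with toℕ i ≤? s
  ... | yes _ = i
  ... | no  _ = opposite i

  rainbow-low : ∀ i → toℕ i ≤ s → rainbowLab i ≡ i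
  rainbow-low i i≤s with toℕ i ≤? s
  ... | yes _   = refl
  ... | no  i≰s = ⊥-elim (i≰s i≤s)

  rainbow-high : ∀ i → s < toℕ i → rainbowLab i ≡ opposite i
  rainbow-high i s<i with toℕ i ≤? s
  ... | yes i≤s = ⊥-elim (<⇒≱ s<i i≤s)
  ... | no  _   = refl

  rainbow-small : ∀ i → toℕ (rainbowLab i) ≤ s
  rainbow-small i with ≤-<-connex (toℕ i) s
  ... | inj₁ i≤s = subst (λ x → toℕ x ≤ s) (sym (rainbow-low i i≤s)) i≤s
  ... | inj₂ s<i = subst (λ x → toℕ x ≤ s) (sym (rainbow-high i s<i)) (mirror-low i s<i)

  rainbow-min : ∀ i → toℕ (rainbowLab i) ≤ toℕ i
  rainbow-min i with ≤-<-connex (toℕ i) s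
  ... | inj₁ i≤s = ≤-reflexive (cong toℕ (rainbow-low i i≤s))
  ... | inj₂ s<i = ≤-trans (rainbow-small i) (<⇒≤ s<i)

  rainbow-block : ∀ a b → rainbowLab a ≡ rainbowLab b → a ≡ b ⊎ toℕ a + toℕ b ≡ m
  rainbow-block a b a~b with ≤-<-connex (toℕ a) s | ≤-<-connex (toℕ b) s
  ... | inj₁ a≤s | inj₁ b≤s = inj₁ (trans (sym (rainbow-low a a≤s)) (trans a~b (rainbow-low b b≤s)))
  ... | inj₁ a≤s | inj₂ s<b = inj₂ (trans (cong (λ x → toℕ x + toℕ b)
                                  (trans (sym (rainbow-low a a≤s)) (trans a~b (rainbow-high b s<b)))) (opposite-sum b))
  ... | inj₂ s<a | inj₁ b≤s = inj₂ (trans (+-comm (toℕ a) (toℕ b)) (trans (cong (λ x → toℕ x + toℕ a)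
                                  (trans (sym (rainbow-low b b≤s)) (trans (sym a~b) (rainbow-high a s<a)))) (opposite-sum a)))
  ... | inj₂ s<a | inj₂ s<b = inj₁ (trans (sym (opposite-involutive a)) (trans (cong opposite
                                  (trans (sym (rainbow-high a s<a)) (trans a~b (rainbow-high b s<b)))) (opposite-involutive b)))

  pair-sum : ∀ a b → toℕ a < toℕ b → rainbowLab a ≡ rainbowLab b → toℕ a + toℕ b ≡ m
  pair-sum a b a<b a~b with rainbow-block a b a~b
  ... | inj₁ refl = ⊥-elim (<-irrefl refl a<b)
  ... | inj₂ a+b≡m = a+b≡m

  -- Two crossing blocks {a,c}, {b,d} would both sum to m, yet a + c < b + d.
  rainbow-noncrossing : ∀ a b c d → toℕ a < toℕ b → toℕ b < toℕ c → toℕ c < toℕ d →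
                        rainbowLab a ≡ rainbowLab c → rainbowLab b ≡ rainbowLab d →
                        rainbowLab a ≡ rainbowLab b
  rainbow-noncrossing a b c d a<b b<c c<d a~c b~d = ⊥-elim (<-irrefl
    (trans (pair-sum a c (<-trans a<b b<c) a~c) (sym (pair-sum b d (<-trans b<c c<d) b~d)))
    (+-mono-< a<b c<d))

  rainbow : NC (suc m)
  rainbow = record
    { lab = rainbowLab
    ; lab-idem = λ i → rainbow-low (rainbowLab i) (rainbow-small i)
    ; lab-min = rainbow-min
    ; noncrossing = rainbow-noncrossing
    }

  -- The first t points have mirror images beyond s, and 0, …, s lead distinct
  -- blocks; W(m+1,m+1) is empty since m + 1 ≮ m + 1.
  rainbow-in-Y : Y (suc m) m rainbow
  rainbow-in-Y = (≤-refl , mate , distinct) , λ w → <-irrefl refl (proj₁ w)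
    where
      mate : ∀ i → toℕ i < t → NotSingleton rainbow i
      mate i i<t = opposite i , opposite≢i , (begin
        rainbowLab (opposite i) ≡⟨ rainbow-high (opposite i) (mirror-high i i<t) ⟩
        opposite (opposite i)   ≡⟨ opposite-involutive i ⟩
        i                       ≡⟨ sym (rainbow-low i (below-nsBound i<t)) ⟩
        rainbowLab i            ∎)
        where
          open ≡-Reasoning
          opposite≢i : opposite i ≢ i
          opposite≢i eq = <⇒≱ (mirror-high i i<t) (subst (λ x → toℕ x ≤ s) (sym eq) (below-nsBound i<t))
      distinct : ∀ i j → toℕ i ≤ s → toℕ j ≤ s → i ≢ j → rainbowLab i ≢ rainbowLab j
      distinct i j i≤s j≤s i≢j i~j = i≢j (trans (sym (rainbow-low i i≤s)) (trans i~j (rainbow-low j j≤s)))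

  -- The blocks are led by 0, …, s.
  rainbow-blocks : blockCount rainbow ≡ suc s
  rainbow-blocks = trans (cong sum (map-tabulate id indicator))
    (count-prefix (suc m) (suc s) indicator (s≤s (≤-trans (m≤m+n s t) (≤-reflexive s+t≡m))) leads follows)
    where
      indicator : Fin (suc m) → ℕ
      indicator i = if eqF (rainbowLab i) i then 1 else 0
      leads : ∀ i → toℕ i < suc s → indicator i ≡ 1
      leads i i≤s = if-true (eqF-complete (rainbow-low i (s≤s⁻¹ i≤s)))
      follows : ∀ i → suc s ≤ toℕ i → indicator i ≡ 0
      follows i s<i = if-false λ h → <⇒≱ s<i (subst (λ x → toℕ x ≤ s) (eqF-sound h) (rainbow-small i))

-- Uniqueness: the rainbow partition is the only element of W(m+1, m)

module Uniqueness (m : ℕ) (q : NC (suc m)) (w : W (suc m) m q) where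
  open Rainbow m
  open InW {suc m} {m} {q} w

  point : ∀ {k} → k < t → Fin (suc m)
  point k<t = fromℕ< (≤-trans k<t (≤-trans (m≤n+m t s) (≤-trans (≤-reflexive s+t≡m) (n≤1+n m))))

  point<t : ∀ {k} (k<t : k < t) → toℕ (point k<t) < t
  point<t k<t = subst (_< t) (sym (toℕ-fromℕ< _)) k<t

  -- partner k: a block-mate, beyond s, of the point k < t (0 otherwise)
  partner : ℕ → ℕ
  partner k with k <? t
  ... | yes k<t = toℕ (proj₁ (notSingleton (point k<t) (point<t k<t)))
  ... | no  _   = 0

  partner-spec : ∀ k → k < t →
                 Σ (Fin (suc m)) λ j → partner k ≡ toℕ j × toℕ (lab q j) ≡ k × s < toℕ j
  partner-spec k k<t with k <? t
  ... | no k≮t = ⊥-elim (k≮t k<t)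
  ... | yes k<t' = j , refl , lab-j≡k , partner-beyond i j i≤s (proj₁ (proj₂ mate)) j~i
    where
      i = point k<t'
      i≤s = below-nsBound (point<t k<t')
      mate = notSingleton i (point<t k<t')
      j = proj₁ mate
      j~i = proj₂ (proj₂ mate)
      lab-j≡k : toℕ (lab q j) ≡ k
      lab-j≡k = trans (cong toℕ (trans j~i (least-in-block i i≤s))) (toℕ-fromℕ< _)

  -- Blocks of consecutive points are nested, so partners strictly decrease.
  partner-decreasing : ∀ k → suc k < t → partner (suc k) < partner k
  partner-decreasing k k+1<t with partner-spec k (<-trans (n<1+n k) k+1<t) | partner-spec (suc k) k+1<t
  ... | j , pk , lab-j , s<j | j' , pk' , lab-j' , _ =
    subst₂ _<_ (sym pk') (sym pk) (nested q {lab q j} {lab q j'} {j} {j'}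
      (subst₂ _<_ (sym lab-j) (sym lab-j') (n<1+n k))
      (subst (_< toℕ j) (sym lab-j') (≤-<-trans (below-nsBound k+1<t) s<j))
      (lab-idem q j) (lab-idem q j')
      λ same → 1+n≢n (trans (sym lab-j') (trans (cong toℕ (trans (sym (lab-idem q j')) (trans (sym same) (lab-idem q j)))) lab-j)))

  -- The partner of k is m - k: the partners are squeezed into (s, m].
  partner-mirror : ∀ k → k < t → partner k + k ≡ m
  partner-mirror k k<t = ≤-antisym upper lower
    where
      open ≤-Reasoning
      first = partner-spec 0 (≤-<-trans z≤n k<t)
      upper : partner k + k ≤ m
      upper = begin
        partner k + k ≤⟨ decreasing-shift partner t partner-decreasing 0 k z≤n k<t ⟩
        partner 0 + 0 ≡⟨ trans (+-identityʳ _) (proj₁ (proj₂ first)) ⟩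
        toℕ (proj₁ first) ≤⟨ s≤s⁻¹ (toℕ<n (proj₁ first)) ⟩
        m ∎
      l = k + (t ∸ suc k)
      l+1≡t : suc l ≡ t
      l+1≡t = m+[n∸m]≡n k<t
      last = partner-spec l (≤-reflexive l+1≡t)
      lower : m ≤ partner k + k
      lower = begin
        m                     ≡⟨ sym s+t≡m ⟩
        s + t                 ≡⟨ cong (s +_) (sym l+1≡t) ⟩
        s + suc l             ≡⟨ +-suc s l ⟩
        suc s + l             ≤⟨ +-monoˡ-≤ l (proj₂ (proj₂ (proj₂ last))) ⟩
        toℕ (proj₁ last) + l  ≡⟨ cong (_+ l) (sym (proj₁ (proj₂ last))) ⟩
        partner l + l         ≤⟨ decreasing-shift partner t partner-decreasing k l (m≤m+n k _) (≤-reflexive l+1≡t) ⟩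
        partner k + k         ∎

  unique : q ≈P rainbow
  unique x with ≤-<-connex (toℕ x) s
  ... | inj₁ x≤s = trans (least-in-block x x≤s) (sym (rainbow-low x x≤s))
  ... | inj₂ s<x = toℕ-injective (begin
    toℕ (lab q x)          ≡⟨ cong (toℕ ∘ lab q) (sym j≡x) ⟩
    toℕ (lab q j)          ≡⟨ proj₁ (proj₂ (proj₂ spec)) ⟩
    k                      ≡⟨ sym (opposite-prop x) ⟩
    toℕ (opposite x)       ≡⟨ cong toℕ (sym (rainbow-high x s<x)) ⟩
    toℕ (rainbowLab x)     ∎)
    where
      open ≡-Reasoning
      k = m ∸ toℕ x
      k+x≡m : k + toℕ x ≡ m
      k+x≡m = m∸n+n≡m (s≤s⁻¹ (toℕ<n x))
      k<t : k < t
      k<t = +-cancelʳ-< (toℕ x) k t (≤-trans (≤-reflexive (cong suc (trans k+x≡m (trans (sym s+t≡m) (+-comm s t)))))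
                                             (+-monoʳ-< t s<x))
      spec = partner-spec k k<t
      j = proj₁ spec
      j≡x : j ≡ x
      j≡x = toℕ-injective (+-cancelʳ-≡ k (toℕ j) (toℕ x)
              (trans (cong (_+ k) (sym (proj₁ (proj₂ spec)))) (trans (partner-mirror k k<t) (trans (sym k+x≡m) (+-comm k (toℕ x))))))

proposition5p24 : (N n : ℕ) → 1 ≤ n →
    Σ (NC n) λ p → Σ (Y n (n ∸ 1) p) λ yp →
      (∀ q → W n (n ∸ 1) q → q ≈P p)
      × (∀ q → Y n (n ∸ 1) q → q ≈P p)
      × (B N n (n ∸ 1) p p yp yp ≡ N ^ ⌈ n /2⌉)
      × (A N n (n ∸ 1) p p (proj₁ yp) (proj₁ yp) ≡ N ^ ⌈ n /2⌉)
proposition5p24 N (suc m) _ =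
  rainbow , rainbow-in-Y ,
  (λ q w → Uniqueness.unique m q w) , (λ q y → Uniqueness.unique m q (proj₁ y)) ,
  entry , entry
  where
    open Rainbow m
    open ≡-Reasoning
    entry : e N m rainbow rainbow ≡ N ^ ⌈ suc m /2⌉
    entry = begin
      e N m rainbow rainbow  ≡⟨ if-true (InW.diagonal-flawless (proj₁ rainbow-in-Y)) ⟩
      N ^ c rainbow rainbow  ≡⟨ cong (N ^_) (components-diagonal rainbow) ⟩
      N ^ blockCount rainbow ≡⟨ cong (N ^_) rainbow-blocks ⟩
      N ^ suc s              ∎
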